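{- Let $\mathcal{B}\subset\mathbb{Z}$ be finite, $c\in\mathbb{Z}$, $x\in\mathbb{N}$ and $\ell\ge x+1$ be such that $\mathcal{B}(x)^{\sharp}$ contains $[c,c+\ell]\cap\mathbb{Z}$. If there exists an integer $y\ge x+1$ such that $\mathcal{B}(y)^{\sharp}$ does not contain $$\Big[c-\sum_{b\in\mathcal{B}(x+1,y),\,b<0}|b|,\ c+\ell-1+\sum_{b\in\mathcal{B}(x+1,y),\,b>0}|b|\Big]\cap\mathbb{Z},$$ and $z$ is the least such integer, then $z\ge \ell+\sum_{b\in\mathcal{B}(x+1,z-1)}|b|+1$.
   Context: For a finite set $\mathcal{B}\subset\mathbb{Z}$, $\mathcal{B}^{\sharp}=\{\sum_{b\in\mathcal{S}}b:\emptyset\ne\mathcal{S}\subset\mathcal{B}\}$. For nonnegative reals $u,v$, $\mathcal{B}(u,v)=\{b\in\mathcal{B}:u\le|b|\le v\}$ and $\mathcal{B}(v)=\mathcal{B}(0,v)$. -}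

module Defs where

open import Data.Nat as ℕ using (ℕ)
open import Data.Integer as ℤ using (ℤ; ∣_∣; _<?_; 0ℤ)
open import Data.List using (List; []; filter; map; foldr)
import Data.Nat.ListAction as NL
open import Data.List.Relation.Binary.Sublist.Propositional using (_⊆_)
open import Data.Product using (∃-syntax; _×_)
open import Relation.Nullary.Decidable using (_×-dec_)
open import Relation.Binary.PropositionalEquality using (_≡_; _≢_)

sumℤ : List ℤ → ℤ
sumℤ = foldr ℤ._+_ 0ℤ

absSum : List ℤ → ℕ
absSum xs = NL.sum (map ∣_∣ xs)

range : List ℤ → ℕ → ℕ → List ℤ
range B u v = filter (λ b → (u ℕ.≤? ∣ b ∣) ×-dec (∣ b ∣ ℕ.≤? v)) B

upto : List ℤ → ℕ → List ℤ
upto B v = range B 0 v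

negatives : List ℤ → List ℤ
negatives = filter (λ b → b <? 0ℤ)

positives : List ℤ → List ℤ
positives = filter (λ b → 0ℤ <? b)

-- n ∈ B^♯ : n is the sum of a nonempty sub-collection of B
-- (for a duplicate-free list B, sublists correspond to subsets)
_∈♯_ : ℤ → List ℤ → Set
n ∈♯ B = ∃[ S ] (S ⊆ B × S ≢ [] × sumℤ S ≡ n)

IntervalIn♯ : ℤ → ℤ → List ℤ → Set
IntervalIn♯ lo hi A = ∀ (n : ℤ) → lo ℤ.≤ n → n ℤ.≤ hi → n ∈♯ A

-- Write B(u,v) for the elements b of B with u ≤ |b| ≤ v, and let N_y, P_y be
-- the total size of the negative, resp. positive, elements of B(x+1,y); the
-- theorem concerns I_y = [c − N_y, c + ℓ − 1 + P_y].  Let z = y + 1 be the least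
-- level with I_z ⊈ B(z)^♯ and suppose, for contradiction, z ≤ ℓ + Σ|B(x+1,y)|.
-- Then I_y ⊆ B(y)^♯ (by minimality of z, or from [c, c+ℓ] ⊆ B(x)^♯ if y = x)
-- and I_y has length ℓ − 1 + N_y + P_y ≥ y (the length of [lo, hi] being
-- hi − lo).  The key fact (`extend`): if an interval of length ≥ y is covered by a set X, and every element of a list T
-- has |t| ≤ y + 1, then the sums X + (sub-sum of T) cover the interval
-- stretched downwards by the negative and upwards by the positive elements of
-- T, one element at a time.  For T the layer {b ∈ B : |b| = z}, which is
-- disjoint from B(y) with B(y) ∪ T = B(z), this yields I_z ⊆ B(z)^♯.

module Submission where

open import Defs
open import Data.Nat as ℕ using (ℕ; suc; _∸_)
open import Data.Integer as ℤ using (ℤ; +_; +[1+_]; -[1+_]; 0ℤ; 1ℤ; ∣_∣; _<?_)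
open import Data.List using (List; []; _∷_; _++_; filter; map)
open import Data.List.Relation.Unary.Unique.Propositional using (Unique)
open import Relation.Nullary using (¬_; yes; no)
open import Data.Empty using (⊥-elim)
open import Data.Product using (∃-syntax; _×_; _,_; proj₂)
open import Data.Sum using (_⊎_; inj₁; inj₂; [_,_])
open import Function using (_∘_)
open import Level using (0ℓ)
open import Relation.Nullary.Decidable using (_×-dec_)
open import Relation.Unary using (Pred; Decidable; _≐_; _∪_; _∩_; Empty)
open import Relation.Binary.PropositionalEquality using (_≡_; _≢_; refl; sym; trans; cong; subst; module ≡-Reasoning)
import Data.Nat.Properties as ℕP
open import Algebra.Properties.CommutativeSemigroup ℕP.+-commutativeSemigroup
  using () renaming (x∙yz≈y∙xz to +-leftComm)
import Data.Integer.Properties as ℤP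
open import Data.Integer.Tactic.RingSolver using (solve-∀)
open import Data.Nat.ListAction using (sum)
open import Data.Nat.ListAction.Properties using (sum-++; sum-↭)
open import Data.List.Properties using (filter-++; map-++; filter-none; filter-accept; filter-reject)
open import Data.List.Relation.Unary.All as All using (All; []; _∷_)
open import Data.List.Relation.Unary.All.Properties using (all-filter)
open import Data.List.Relation.Binary.Sublist.Propositional using (_⊆_; []; _∷_; _∷ʳ_; ⊆-refl; ⊆-trans)
open import Data.List.Relation.Binary.Sublist.Propositional.Properties using (All-resp-⊆; filter⁺)
open import Data.List.Relation.Binary.Permutation.Propositional using (_↭_; ↭-refl; ↭-reflexive; ↭-sym; ↭-trans; prep)
import Data.List.Relation.Binary.Permutation.Propositional.Properties as Perm
open import Data.List.Relation.Ternary.Interleaving.Propositional using (Interleaving; []; consˡ; consʳ)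

Covers : ℤ → ℤ → Pred ℤ 0ℓ → Set
Covers lo hi P = ∀ n → lo ℤ.≤ n → n ℤ.≤ hi → P n

Covers-map : ∀ {lo hi} {P Q : Pred ℤ 0ℓ} → (∀ {n} → P n → Q n) → Covers lo hi P → Covers lo hi Q
Covers-map f H n lo≤n n≤hi = f (H n lo≤n n≤hi)

Covers-resp : ∀ {lo lo′ hi hi′} {P : Pred ℤ 0ℓ} → lo′ ≡ lo → hi′ ≡ hi → Covers lo hi P → Covers lo′ hi′ P
Covers-resp refl refl H = H

≤-moveˡ : ∀ {i j} k → i ℤ.+ k ℤ.≤ j → i ℤ.≤ j ℤ.- k
≤-moveˡ {i} {j} k i+k≤j = subst (ℤ._≤ j ℤ.- k) (cancel i k) (ℤP.+-monoˡ-≤ (ℤ.- k) i+k≤j)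
  where cancel : ∀ i k → i ℤ.+ k ℤ.- k ≡ i
        cancel = solve-∀

≤-moveʳ : ∀ {i j} k → i ℤ.≤ j ℤ.+ k → i ℤ.- k ℤ.≤ j
≤-moveʳ {i} {j} k i≤j+k = subst (i ℤ.- k ℤ.≤_) (cancel j k) (ℤP.+-monoˡ-≤ (ℤ.- k) i≤j+k)
  where cancel : ∀ j k → j ℤ.+ k ℤ.- k ≡ j
        cancel = solve-∀

≤-unmoveˡ : ∀ {i j} k → i ℤ.- k ℤ.≤ j → i ℤ.≤ j ℤ.+ k
≤-unmoveˡ {i} {j} k i-k≤j = subst (ℤ._≤ j ℤ.+ k) (cancel i k) (ℤP.+-monoˡ-≤ k i-k≤j)
  where cancel : ∀ i k → i ℤ.- k ℤ.+ k ≡ i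
        cancel = solve-∀

cover-up : ∀ {lo hi y d} {P : Pred ℤ 0ℓ} → Covers lo hi P → lo ℤ.+ + y ℤ.≤ hi → d ℕ.≤ suc y →
           Covers lo (hi ℤ.+ + d) (λ n → P n ⊎ P (n ℤ.- + d))
cover-up {lo} {hi} {y} {d} H long d≤ n lo≤n n≤hi+d with n ℤ.≤? hi
... | yes n≤hi = inj₁ (H n lo≤n n≤hi)
... | no n≰hi = inj₂ (H (n ℤ.- + d) (≤-moveˡ (+ d) lo+d≤n) (≤-moveʳ (+ d) n≤hi+d))
  where
  open ℤP.≤-Reasoning
  shuffle : ∀ lo t → lo ℤ.+ (1ℤ ℤ.+ t) ≡ 1ℤ ℤ.+ (lo ℤ.+ t)
  shuffle = solve-∀
  lo+d≤n : lo ℤ.+ + d ℤ.≤ n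
  lo+d≤n = begin
    lo ℤ.+ + d          ≤⟨ ℤP.+-monoʳ-≤ lo (ℤ.+≤+ d≤) ⟩
    lo ℤ.+ + suc y      ≡⟨ shuffle lo (+ y) ⟩
    1ℤ ℤ.+ (lo ℤ.+ + y) ≤⟨ ℤP.+-monoʳ-≤ 1ℤ long ⟩
    1ℤ ℤ.+ hi           ≤⟨ ℤP.i<j⇒suc[i]≤j (ℤP.≰⇒> n≰hi) ⟩
    n                   ∎

cover-down : ∀ {lo hi y d} {P : Pred ℤ 0ℓ} → Covers lo hi P → lo ℤ.+ + y ℤ.≤ hi → d ℕ.≤ suc y →
             Covers (lo ℤ.- + d) hi (λ n → P n ⊎ P (n ℤ.+ + d))
cover-down {lo} {hi} {y} {d} H long d≤ n lo-d≤n n≤hi with lo ℤ.≤? n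
... | yes lo≤n = inj₁ (H n lo≤n n≤hi)
... | no lo≰n = inj₂ (H (n ℤ.+ + d) (≤-unmoveˡ (+ d) lo-d≤n) n+d≤hi)
  where
  open ℤP.≤-Reasoning
  shuffle : ∀ n t → n ℤ.+ (1ℤ ℤ.+ t) ≡ (1ℤ ℤ.+ n) ℤ.+ t
  shuffle = solve-∀
  n+d≤hi : n ℤ.+ + d ℤ.≤ hi
  n+d≤hi = begin
    n ℤ.+ + d          ≤⟨ ℤP.+-monoʳ-≤ n (ℤ.+≤+ d≤) ⟩
    n ℤ.+ + suc y      ≡⟨ shuffle n (+ y) ⟩
    (1ℤ ℤ.+ n) ℤ.+ + y ≤⟨ ℤP.+-monoˡ-≤ (+ y) (ℤP.i<j⇒suc[i]≤j (ℤP.≰⇒> lo≰n)) ⟩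
    lo ℤ.+ + y         ≤⟨ long ⟩
    hi                 ∎

widen-long : ∀ {lo hi} y a b → lo ℤ.+ + y ℤ.≤ hi → (lo ℤ.- + a) ℤ.+ + y ℤ.≤ hi ℤ.+ + b
widen-long {lo} {hi} y a b long =
  ℤP.≤-trans (ℤP.+-monoˡ-≤ (+ y) (ℤP.i-j≤i lo (+ a))) (ℤP.≤-trans long (ℤP.i≤i+j hi (+ b)))

Shifted : Pred ℤ 0ℓ → List ℤ → Pred ℤ 0ℓ
Shifted P T n = ∃[ U ] U ⊆ T × P (n ℤ.- sumℤ U)

shifted-∷ : ∀ {P : Pred ℤ 0ℓ} {T n} e → Shifted P T n ⊎ Shifted P T (n ℤ.- e) → Shifted P (e ∷ T) n
shifted-∷ e (inj₁ (U , U⊆T , p)) = U , e ∷ʳ U⊆T , p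
shifted-∷ {P} {n = n} e (inj₂ (U , U⊆T , p)) = e ∷ U , refl ∷ U⊆T , subst P (reassoc n e (sumℤ U)) p
  where reassoc : ∀ n e u → n ℤ.- e ℤ.- u ≡ n ℤ.- (e ℤ.+ u)
        reassoc = solve-∀

extend : ∀ {lo hi y} {P : Pred ℤ 0ℓ} T → Covers lo hi P → lo ℤ.+ + y ℤ.≤ hi →
         All (λ t → ∣ t ∣ ℕ.≤ suc y) T →
         Covers (lo ℤ.- + absSum (negatives T)) (hi ℤ.+ + absSum (positives T)) (Shifted P T)
extend {lo} {hi} {P = P} [] H long [] =
  Covers-resp (ℤP.+-identityʳ lo) (ℤP.+-identityʳ hi)
    (Covers-map (λ {n} p → [] , [] , subst P (sym (ℤP.+-identityʳ n)) p) H)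
extend {P = P} (+ 0 ∷ T) H long (_ ∷ small) =
  Covers-map (λ {n} → shifted-∷ {P} {T} {n} (+ 0) ∘ inj₁) (extend T H long small)
extend {lo} {hi} {y} {P} (+[1+ k ] ∷ T) H long (e≤ ∷ small) =
  Covers-map (λ {n} → shifted-∷ {P} {T} {n} (+[1+ k ])) (Covers-resp refl (stretch hi (suc k) posT)
    (cover-up (extend T H long small) (widen-long {lo} y negT posT long) e≤))
  where
  negT = absSum (negatives T)
  posT = absSum (positives T)
  stretch : ∀ hi a b → hi ℤ.+ + (a ℕ.+ b) ≡ (hi ℤ.+ + b) ℤ.+ + a
  stretch hi a b = trans (cong (λ t → hi ℤ.+ t) (ℤP.pos-+ a b)) (swap hi (+ a) (+ b))
    where swap : ∀ h a b → h ℤ.+ (a ℤ.+ b) ≡ (h ℤ.+ b) ℤ.+ a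
          swap = solve-∀
extend {lo} {hi} {y} {P} (-[1+ k ] ∷ T) H long (e≤ ∷ small) =
  Covers-map (λ {n} → shifted-∷ {P} {T} {n} (-[1+ k ])) (Covers-resp (stretch lo (suc k) negT) refl
    (cover-down (extend T H long small) (widen-long {lo} y negT posT long) e≤))
  where
  negT = absSum (negatives T)
  posT = absSum (positives T)
  stretch : ∀ lo a b → lo ℤ.- + (a ℕ.+ b) ≡ (lo ℤ.- + b) ℤ.- + a
  stretch lo a b = trans (cong (λ t → lo ℤ.- t) (ℤP.pos-+ a b)) (swap lo (+ a) (+ b))
    where swap : ∀ l a b → l ℤ.- (a ℤ.+ b) ≡ (l ℤ.- b) ℤ.- a
          swap = solve-∀

-- Two sublists of L whose elements are separated by P (P holds on S and fails
-- on U) never pick the same position of L, so they interleave inside L.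
interleave : ∀ {A : Set} {P : Pred A 0ℓ} {S U L : List A} → S ⊆ L → U ⊆ L →
             All P S → All (¬_ ∘ P) U → ∃[ M ] M ⊆ L × Interleaving S U M
interleave [] [] [] [] = [] , [] , []
interleave (x ∷ʳ s) (.x ∷ʳ u) pS ¬pU =
  let M , m , i = interleave s u pS ¬pU in M , x ∷ʳ m , i
interleave (refl ∷ s) (x ∷ʳ u) (p ∷ pS) ¬pU =
  let M , m , i = interleave s u pS ¬pU in x ∷ M , refl ∷ m , consˡ i
interleave (x ∷ʳ s) (refl ∷ u) pS (¬p ∷ ¬pU) =
  let M , m , i = interleave s u pS ¬pU in x ∷ M , refl ∷ m , consʳ i
interleave (refl ∷ s) (refl ∷ u) (p ∷ _) (¬p ∷ _) = ⊥-elim (¬p p)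

interleaving-sum : ∀ {S U M} → Interleaving S U M → sumℤ M ≡ sumℤ S ℤ.+ sumℤ U
interleaving-sum [] = refl
interleaving-sum {b ∷ S} {U} (consˡ i) =
  trans (cong (λ t → b ℤ.+ t) (interleaving-sum i)) (sym (ℤP.+-assoc b (sumℤ S) (sumℤ U)))
interleaving-sum {S} {b ∷ U} (consʳ i) =
  trans (cong (λ t → b ℤ.+ t) (interleaving-sum i)) (swap b (sumℤ S) (sumℤ U))
  where swap : ∀ b s u → b ℤ.+ (s ℤ.+ u) ≡ s ℤ.+ (b ℤ.+ u)
        swap = solve-∀

interleaving-nonempty : ∀ {S U M : List ℤ} → Interleaving S U M → S ≢ [] → M ≢ []
interleaving-nonempty [] S≢[] _ = S≢[] refl

layer : List ℤ → ℕ → List ℤ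
layer B v = filter (λ b → ∣ b ∣ ℕ.≟ v) B

InRange : ℕ → ℕ → Pred ℤ 0ℓ
InRange u v b = u ℕ.≤ ∣ b ∣ × ∣ b ∣ ℕ.≤ v

inRange? : ∀ u v → Decidable (InRange u v)
inRange? u v b = (u ℕ.≤? ∣ b ∣) ×-dec (∣ b ∣ ℕ.≤? v)

range-empty : ∀ B {u v} → v ℕ.< u → range B u v ≡ []
range-empty B v<u = filter-none (inRange? _ _)
  (All.universal (λ b (u≤b , b≤v) → ℕP.<-irrefl refl (ℕP.<-≤-trans v<u (ℕP.≤-trans u≤b b≤v))) B)

filter-partition : ∀ {A : Set} {P Q R : Pred A 0ℓ} (P? : Decidable P) (Q? : Decidable Q) (R? : Decidable R) →
                   P ≐ Q ∪ R → Empty (Q ∩ R) → ∀ xs → filter P? xs ↭ filter Q? xs ++ filter R? xs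
filter-partition P? Q? R? P≐Q∪R Q∩R≡∅ [] = ↭-refl
filter-partition P? Q? R? (P⊆ , ⊆P) Q∩R≡∅ (x ∷ xs) with Q? x | R? x
... | yes q | yes r = ⊥-elim (Q∩R≡∅ x (q , r))
... | yes q | no _ = ↭-trans (↭-reflexive (filter-accept P? (⊆P (inj₁ q)))) (prep x rest)
  where rest = filter-partition P? Q? R? (P⊆ , ⊆P) Q∩R≡∅ xs
... | no _ | yes r = ↭-trans (↭-reflexive (filter-accept P? (⊆P (inj₂ r))))
                             (↭-trans (prep x rest) (↭-sym (Perm.shift x _ _)))
  where rest = filter-partition P? Q? R? (P⊆ , ⊆P) Q∩R≡∅ xs
... | no ¬q | no ¬r = ↭-trans (↭-reflexive (filter-reject P? ([ ¬q , ¬r ] ∘ P⊆))) rest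
  where rest = filter-partition P? Q? R? (P⊆ , ⊆P) Q∩R≡∅ xs

range-layer : ∀ B {u y} → u ℕ.≤ suc y → range B u (suc y) ↭ range B u y ++ layer B (suc y)
range-layer B {u} {y} u≤ = filter-partition (inRange? u (suc y)) (inRange? u y) (λ b → ∣ b ∣ ℕ.≟ suc y)
  ((λ {b} → split {b}) , (λ {b} → merge {b})) (λ b ((_ , b≤y) , b≡) → ℕP.<-irrefl b≡ (ℕ.s≤s b≤y)) B
  where
  split : ∀ {b} → InRange u (suc y) b → InRange u y b ⊎ ∣ b ∣ ≡ suc y
  split (u≤b , b≤) with ℕP.m≤n⇒m<n∨m≡n b≤
  ... | inj₁ b<sy = inj₁ (u≤b , ℕP.≤-pred b<sy)
  ... | inj₂ b≡ = inj₂ b≡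
  merge : ∀ {b} → InRange u y b ⊎ ∣ b ∣ ≡ suc y → InRange u (suc y) b
  merge (inj₁ (u≤b , b≤y)) = u≤b , ℕP.m≤n⇒m≤1+n b≤y
  merge (inj₂ b≡) = subst (u ℕ.≤_) (sym b≡) u≤ , ℕP.≤-reflexive b≡

absSum-filter-split : ∀ {S : Pred ℤ 0ℓ} (S? : Decidable S) {xs} ys zs → xs ↭ ys ++ zs →
                      absSum (filter S? xs) ≡ absSum (filter S? ys) ℕ.+ absSum (filter S? zs)
absSum-filter-split S? {xs} ys zs xs↭ = begin
  absSum (filter S? xs)                         ≡⟨ sum-↭ (Perm.map⁺ ∣_∣ (Perm.filter-↭ S? xs↭)) ⟩
  absSum (filter S? (ys ++ zs))                 ≡⟨ cong absSum (filter-++ S? ys zs) ⟩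
  sum (map ∣_∣ (filter S? ys ++ filter S? zs))  ≡⟨ cong sum (map-++ ∣_∣ (filter S? ys) (filter S? zs)) ⟩
  sum (map ∣_∣ (filter S? ys) ++ map ∣_∣ (filter S? zs)) ≡⟨ sum-++ (map ∣_∣ (filter S? ys)) _ ⟩
  absSum (filter S? ys) ℕ.+ absSum (filter S? zs) ∎
  where open ≡-Reasoning

absSum-signs : ∀ xs → absSum xs ≡ absSum (negatives xs) ℕ.+ absSum (positives xs)
absSum-signs [] = refl
absSum-signs (+ 0 ∷ xs) = absSum-signs xs
absSum-signs (+[1+ k ] ∷ xs) =
  trans (cong (suc k ℕ.+_) (absSum-signs xs)) (+-leftComm (suc k) (absSum (negatives xs)) _)
absSum-signs (-[1+ k ] ∷ xs) =
  trans (cong (suc k ℕ.+_) (absSum-signs xs)) (sym (ℕP.+-assoc (suc k) (absSum (negatives xs)) _))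

layer-sum : ∀ B y {n} → Shifted (_∈♯ upto B y) (layer B (suc y)) n → n ∈♯ upto B (suc y)
layer-sum B y {n} (U , U⊆L , S , S⊆ , S≢[] , ΣS≡) =
  let M , M⊆ , i = interleave (⊆-trans S⊆ upto-step) (⊆-trans U⊆L layer⊆upto)
                     (All.map proj₂ (All-resp-⊆ S⊆ (all-filter (inRange? 0 y) B)))
                     (All.map (λ b≡ b≤y → ℕP.<-irrefl b≡ (ℕ.s≤s b≤y)) (All-resp-⊆ U⊆L (all-filter _ B)))
  in M , M⊆ , interleaving-nonempty i S≢[] ,
     trans (interleaving-sum i) (trans (cong (ℤ._+ sumℤ U) ΣS≡) (cancel n (sumℤ U)))
  where
  upto-step : upto B y ⊆ upto B (suc y)
  upto-step = filter⁺ (inRange? 0 y) (inRange? 0 (suc y))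
                      (λ { refl (_ , b≤y) → ℕ.z≤n , ℕP.m≤n⇒m≤1+n b≤y }) (⊆-refl {x = B})
  layer⊆upto : layer B (suc y) ⊆ upto B (suc y)
  layer⊆upto = filter⁺ _ (inRange? 0 (suc y))
                       (λ { refl b≡ → ℕ.z≤n , ℕP.≤-reflexive b≡ }) (⊆-refl {x = B})
  cancel : ∀ n u → n ℤ.- u ℤ.+ u ≡ n
  cancel = solve-∀

level-step : ∀ B u y {a b} → u ℕ.≤ suc y →
  IntervalIn♯ (a ℤ.- + absSum (negatives (range B u y))) (b ℤ.+ + absSum (positives (range B u y))) (upto B y) →
  (a ℤ.- + absSum (negatives (range B u y))) ℤ.+ + y ℤ.≤ b ℤ.+ + absSum (positives (range B u y)) →
  IntervalIn♯ (a ℤ.- + absSum (negatives (range B u (suc y)))) (b ℤ.+ + absSum (positives (range B u (suc y))))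
              (upto B (suc y))
level-step B u y {a} {b} u≤ H long =
  Covers-resp (lower-end a) (upper-end b)
    (Covers-map (layer-sum B y) (extend (layer B (suc y)) H long layer-small))
  where
  N P : List ℤ → ℕ
  N = absSum ∘ negatives
  P = absSum ∘ positives
  layer-small : All (λ t → ∣ t ∣ ℕ.≤ suc y) (layer B (suc y))
  layer-small = All.map ℕP.≤-reflexive (all-filter _ B)
  split : ∀ {S : Pred ℤ 0ℓ} (S? : Decidable S) → absSum (filter S? (range B u (suc y))) ≡
          absSum (filter S? (range B u y)) ℕ.+ absSum (filter S? (layer B (suc y)))
  split S? = absSum-filter-split S? (range B u y) (layer B (suc y)) (range-layer B u≤)
  lower-end : ∀ a → a ℤ.- + absSum (negatives (range B u (suc y))) ≡
              (a ℤ.- + absSum (negatives (range B u y))) ℤ.- + absSum (negatives (layer B (suc y)))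
  lower-end a = trans (cong (λ t → a ℤ.- + t) (split (λ b → b <? 0ℤ)))
                      (trans (cong (λ t → a ℤ.- t) (ℤP.pos-+ (N (range B u y)) (N (layer B (suc y)))))
                             (reassoc a _ _))
    where reassoc : ∀ a m n → a ℤ.- (m ℤ.+ n) ≡ (a ℤ.- m) ℤ.- n
          reassoc = solve-∀
  upper-end : ∀ b → b ℤ.+ + absSum (positives (range B u (suc y))) ≡
              (b ℤ.+ + absSum (positives (range B u y))) ℤ.+ + absSum (positives (layer B (suc y)))
  upper-end b = trans (cong (λ t → b ℤ.+ + t) (split (λ b → 0ℤ <? b)))
                      (trans (cong (λ t → b ℤ.+ t) (ℤP.pos-+ (P (range B u y)) (P (layer B (suc y)))))
                             (sym (ℤP.+-assoc b _ _)))

Covered : List ℤ → ℤ → ℕ → ℕ → ℕ → Set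
Covered B c x ℓ y =
  IntervalIn♯ (c ℤ.- + absSum (negatives (range B (suc x) y)))
              (c ℤ.+ + ℓ ℤ.- + 1 ℤ.+ + absSum (positives (range B (suc x) y)))
              (upto B y)

-- At y = x the sums are empty and I_x = [c, c + ℓ − 1] ⊆ [c, c + ℓ].
covered-start : ∀ B c x ℓ → IntervalIn♯ c (c ℤ.+ + ℓ) (upto B x) → Covered B c x ℓ x
covered-start B c x ℓ H rewrite range-empty B {suc x} {x} ℕP.≤-refl =
  Covers-resp (ℤP.+-identityʳ c) (ℤP.+-identityʳ _)
    (λ n c≤n n≤ → H n c≤n (ℤP.≤-trans n≤ (ℤP.i-j≤i (c ℤ.+ + ℓ) 1ℤ)))

covered-below : ∀ B c x ℓ y → x ℕ.≤ y → IntervalIn♯ c (c ℤ.+ + ℓ) (upto B x) →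
                (∀ y′ → suc x ℕ.≤ y′ → y′ ℕ.< suc y → Covered B c x ℓ y′) → Covered B c x ℓ y
covered-below B c x ℓ y x≤y H below with ℕP.m≤n⇒m<n∨m≡n x≤y
... | inj₁ x<y = below y x<y ℕP.≤-refl
... | inj₂ refl = covered-start B c x ℓ H

covered-long : ∀ c ℓ y N P → suc y ℕ.≤ ℓ ℕ.+ (N ℕ.+ P) →
               (c ℤ.- + N) ℤ.+ + y ℤ.≤ c ℤ.+ + ℓ ℤ.- + 1 ℤ.+ + P
covered-long c ℓ y N P sy≤ = begin
  (c ℤ.- + N) ℤ.+ + y                 ≡⟨ shift-one c (+ N) (+ y) ⟩
  (c ℤ.- + N ℤ.- 1ℤ) ℤ.+ + suc y       ≤⟨ ℤP.+-monoʳ-≤ (c ℤ.- + N ℤ.- 1ℤ) (ℤ.+≤+ sy≤) ⟩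
  (c ℤ.- + N ℤ.- 1ℤ) ℤ.+ + (ℓ ℕ.+ (N ℕ.+ P))
    ≡⟨ cong (λ t → (c ℤ.- + N ℤ.- 1ℤ) ℤ.+ t) (trans (ℤP.pos-+ ℓ _) (cong (λ t → + ℓ ℤ.+ t) (ℤP.pos-+ N P))) ⟩
  (c ℤ.- + N ℤ.- 1ℤ) ℤ.+ (+ ℓ ℤ.+ (+ N ℤ.+ + P)) ≡⟨ collect c (+ ℓ) (+ N) (+ P) ⟩
  c ℤ.+ + ℓ ℤ.- + 1 ℤ.+ + P ∎
  where
  open ℤP.≤-Reasoning
  shift-one : ∀ c n y → (c ℤ.- n) ℤ.+ y ≡ (c ℤ.- n ℤ.- 1ℤ) ℤ.+ (1ℤ ℤ.+ y)
  shift-one = solve-∀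
  collect : ∀ c l n p → (c ℤ.- n ℤ.- 1ℤ) ℤ.+ (l ℤ.+ (n ℤ.+ p)) ≡ c ℤ.+ l ℤ.- 1ℤ ℤ.+ p
  collect = solve-∀

lemma2 : (B : List ℤ) → Unique B → (c : ℤ) → (x ℓ : ℕ) → suc x ℕ.≤ ℓ →
    IntervalIn♯ c (c ℤ.+ + ℓ) (upto B x) →
    (z : ℕ) → suc x ℕ.≤ z →
    ¬ IntervalIn♯ (c ℤ.- + absSum (negatives (range B (suc x) z)))
                  (c ℤ.+ + ℓ ℤ.- + 1 ℤ.+ + absSum (positives (range B (suc x) z)))
                  (upto B z) →
    (∀ (y : ℕ) → suc x ℕ.≤ y → y ℕ.< z →
      IntervalIn♯ (c ℤ.- + absSum (negatives (range B (suc x) y)))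
                  (c ℤ.+ + ℓ ℤ.- + 1 ℤ.+ + absSum (positives (range B (suc x) y)))
                  (upto B y)) →
    ℓ ℕ.+ absSum (range B (suc x) (z ∸ 1)) ℕ.+ 1 ℕ.≤ z
lemma2 B _ c x ℓ _ H (suc y) x<z uncovered below
  with ℓ ℕ.+ absSum (range B (suc x) y) ℕ.+ 1 ℕ.≤? suc y
... | yes enough = enough
... | no notEnough = ⊥-elim (uncovered (level-step B (suc x) y {c} {c ℤ.+ + ℓ ℤ.- + 1} x<z Iy long))
  where
  N = absSum (negatives (range B (suc x) y))
  P = absSum (positives (range B (suc x) y))
  Iy : Covered B c x ℓ y
  Iy = covered-below B c x ℓ y (ℕP.≤-pred x<z) H below
  -- Failure of the bound means y + 1 ≤ ℓ + Σ|B(x+1,y)|, so I_y is long enough.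
  sy≤ : suc y ℕ.≤ ℓ ℕ.+ absSum (range B (suc x) y)
  sy≤ = ℕP.≤-pred (subst (suc (suc y) ℕ.≤_) (ℕP.+-comm _ 1) (ℕP.≰⇒> notEnough))
  long : (c ℤ.- + N) ℤ.+ + y ℤ.≤ c ℤ.+ + ℓ ℤ.- + 1 ℤ.+ + P
  long = covered-long c ℓ y N P (subst (λ s → suc y ℕ.≤ ℓ ℕ.+ s) (absSum-signs (range B (suc x) y)) sy≤)
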